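{- Let $k$ be a positive integer and $G=(V,E)$ a graph of treewidth at most $k$. For every $X\subseteq V$ with $|X|\leq k+1$ we have $\mathsf{mspd}_k(X,\emptyset)=1$. Moreover, for every good pair $(X,W)$ with $W\neq\emptyset$, $$\mathsf{mspd}_k(X,W)=\min_{\substack{Y\subseteq X\cup W,\ Y\neq X,\\ W\cap N(X\setminus Y)=\emptyset}} \bigl(1+\mathsf{mspd}_k(Y,W\setminus Y)\bigr).$$
   Context: Graphs are finite, simple and undirected; $N(v)$ is the set of neighbours of $v$ and for $S\subseteq V$, $N(S)=\bigcup_{v\in S}N(v)$. A path decomposition of a graph $H$ is a sequence $(X_1,\ldots,X_s)$ of vertex subsets (bags) covering all vertices and all edges of $H$ such that for each vertex $v$ the set $\{i: v\in X_i\}$ is an interval; its width is $\max_i|X_i|-1$, its size is $s$, and $X_s$ is its last bag. A good pair is a pair $(X,W)$ of subsets of $V$ with $|X|\leq k+1$, $X\cap W=\emptyset$, and $N(v)\subseteq W\cup X$ for all $v\in W$. For disjoint $X,W\subseteq V$, $\mathsf{mspd}_k(X,W)$ is the minimum $s$ such that $G[X\cup W]$ has a path decomposition of width at most $k$ and size $s$ whose last bag is $X$ (and $+\infty$ if no such decomposition exists). -}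

module Defs where

open import Level using (0ℓ)
open import Data.Nat using (ℕ; zero; suc; _≤_; _<_)
open import Data.Fin using (Fin; fromℕ)
open import Data.Fin.Subset using (Subset; _∈_; _∉_; _⊆_; _∪_; _─_; ∣_∣; ⊥; Nonempty)
open import Data.List using (List; length; head; last)
open import Data.List.Relation.Unary.All using (All)
open import Data.List.Relation.Unary.Linked using (Linked)
open import Data.List.Relation.Unary.Unique.Propositional using (Unique)
open import Data.Maybe using (Maybe; just; nothing)
open import Data.Product using (Σ; ∃; _×_; _,_)
open import Data.Sum using (_⊎_)
open import Relation.Binary.PropositionalEquality using (_≡_; _≢_)
open import Relation.Nullary using (¬_)

record Graph (n : ℕ) : Set₁ where
  field
    E     : Fin n → Fin n → Set
    sym   : ∀ {u v} → E u v → E v u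
    irrefl : ∀ {u} → ¬ E u u
open Graph public

InN : ∀ {n} → Graph n → Subset n → Fin n → Set
InN G S w = ∃ λ x → x ∈ S × E G x w

IsWalk : ∀ {n} → Graph n → Fin n → Fin n → List (Fin n) → Set
IsWalk G u v xs = Linked (E G) xs × head xs ≡ just u × last xs ≡ just v

Connected : ∀ {n} → Graph n → Set
Connected {n} G = ∀ (u v : Fin n) → ∃ λ xs → IsWalk G u v xs

HasCycle : ∀ {n} → Graph n → Set
HasCycle {n} G = Σ (List (Fin n)) λ xs → Σ (Fin n) λ u → Σ (Fin n) λ v →
  3 ≤ length xs × Unique xs × IsWalk G u v xs × E G v u

IsTree : ∀ {m} → Graph (suc m) → Set
IsTree T = Connected T × ¬ HasCycle T

record TreeDecomposition {n : ℕ} (G : Graph n) (k : ℕ) : Set₁ where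
  field
    m       : ℕ
    T       : Graph (suc m)
    isTree  : IsTree T
    bag     : Fin (suc m) → Subset n
    width   : ∀ a → ∣ bag a ∣ ≤ suc k
    vcover  : ∀ (v : Fin n) → ∃ λ a → v ∈ bag a
    ecover  : ∀ (u v : Fin n) → E G u v → ∃ λ a → u ∈ bag a × v ∈ bag a
    subtree : ∀ (v : Fin n) (a b : Fin (suc m)) → v ∈ bag a → v ∈ bag b →
              ∃ λ xs → IsWalk T a b xs × All (λ c → v ∈ bag c) xs

TwAtMost : ∀ {n} → Graph n → ℕ → Set₁
TwAtMost G k = TreeDecomposition G k

record PathDecomposition {n : ℕ} (G : Graph n) (k : ℕ) (H : Subset n) (s : ℕ) : Set where
  field
    bag      : Fin s → Subset n
    inH      : ∀ i → bag i ⊆ H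
    width    : ∀ i → ∣ bag i ∣ ≤ suc k
    vcover   : ∀ v → v ∈ H → ∃ λ i → v ∈ bag i
    ecover   : ∀ u v → u ∈ H → v ∈ H → E G u v → ∃ λ i → u ∈ bag i × v ∈ bag i
    interval : ∀ v (i j l : Fin s) → i Data.Fin.≤ j → j Data.Fin.≤ l →
               v ∈ bag i → v ∈ bag l → v ∈ bag j

HasMSPD : ∀ {n} → Graph n → ℕ → Subset n → Subset n → ℕ → Set
HasMSPD G k X W zero = Data.Empty.⊥
  where import Data.Empty
HasMSPD G k X W (suc t) =
  Σ (PathDecomposition G k (X ∪ W) (suc t)) λ P →
    PathDecomposition.bag P (fromℕ t) ≡ X

-- ℕ ∪ {+∞} as Maybe ℕ (nothing = +∞)

ℕ∞ : Set
ℕ∞ = Maybe ℕ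

_≤∞_ : ℕ∞ → ℕ∞ → Set
just a  ≤∞ just b  = a ≤ b
just a  ≤∞ nothing = Data.Unit.⊤
  where import Data.Unit
nothing ≤∞ just b  = Data.Empty.⊥
  where import Data.Empty
nothing ≤∞ nothing = Data.Unit.⊤
  where import Data.Unit

1+∞ : ℕ∞ → ℕ∞
1+∞ (just a) = just (suc a)
1+∞ nothing  = nothing

-- m is the minimum (in ℕ ∪ {+∞}) of the set P; min ∅ = +∞
IsMin : (ℕ∞ → Set) → ℕ∞ → Set
IsMin P m = (P m ⊎ m ≡ nothing) × (∀ v → P v → m ≤∞ v)

MspdIs : ∀ {n} → Graph n → ℕ → Subset n → Subset n → ℕ∞ → Set
MspdIs G k X W = IsMin (λ v → ∃ λ s → v ≡ just s × HasMSPD G k X W s)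

Disjoint : ∀ {n} → Subset n → Subset n → Set
Disjoint X W = ∀ v → v ∈ X → v ∈ W → Data.Empty.⊥
  where import Data.Empty

GoodPair : ∀ {n} → Graph n → ℕ → Subset n → Subset n → Set
GoodPair G k X W =
  ∣ X ∣ ≤ suc k × Disjoint X W × (∀ v u → v ∈ W → E G v u → u ∈ W ∪ X)

Admissible : ∀ {n} → Graph n → Subset n → Subset n → Subset n → Set
Admissible G X W Y =
  Y ⊆ X ∪ W × Y ≢ X × (∀ w → w ∈ W → InN G (X ─ Y) w → Data.Empty.⊥)
  where import Data.Empty

RecValues : ∀ {n} → Graph n → ℕ → Subset n → Subset n → ℕ∞ → Set
RecValues {n} G k X W v =
  Σ (Subset n) λ Y → Σ ℕ∞ λ m' →
    Admissible G X W Y × MspdIs G k Y (W ─ Y) m' × v ≡ 1+∞ m'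

module Submission where

-- A decomposition of G[X ∪ W] with last bag X and s+1 bags is, up to its
-- last bag, a decomposition with s bags of G[Y ∪ (W ∖ Y)] for its
-- second-to-last bag Y.  Two general facts about path decompositions make
-- this precise:
--   * appendBag: a bag X may be appended after a decomposition of G[H]
--     whenever X meets H only inside the last bag and every edge from X to
--     H ∖ X starts in H;
--   * dropLastBag: removing the last bag X of a decomposition of G[H] leaves
--     a decomposition of G[Y ∪ (H ∖ X)], and no edge joins X ∖ Y to H ∖ X.
-- For a good pair (X, W) with W ≠ ∅ these say: every admissible Y turns a
-- size s for (Y, W ∖ Y) into a size s+1 for (X, W), and every size s+1 for
-- (X, W) comes from a size s for some (Y, W ∖ Y) with Y admissible or Y = X.
-- An order-theoretic lemma (isMin-transfer) turns these into the equality of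
-- the two minima in ℕ ∪ {+∞}.  Minima of arbitrary predicates on ℕ exist only
-- up to double negation constructively, which suffices because the lower
-- bounds "m ≤ s" are decidable.  The first claim is a one-bag decomposition.

open import Defs
open import Data.Nat using (ℕ; zero; suc; _≤_; _<_; z≤n; s≤s; s≤s⁻¹; _≤?_)
open import Data.Nat.Properties using (≤-trans; m≤n⇒m≤1+n; n<1+n; ≰⇒>; 1+n≰n)
open import Data.Fin using (Fin; fromℕ; punchIn; punchOut; _≟_)
import Data.Fin as Fin
open import Data.Fin.Properties using
  (≤fromℕ; ≤-antisym; punchInᵢ≢i; punchIn-punchOut; punchIn-mono-≤; punchIn-cancel-≤)
open import Data.Fin.Subset using (Subset; _∈_; _∉_; _⊆_; _∪_; _─_; ∣_∣; ⊥; Nonempty; inside; outside)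
open import Data.Fin.Subset.Properties using
  (_∈?_; ∉⊥; p⊆p∪q; q⊆p∪q; x∈p∪q⁻; x∈p∪q⁺; x∈p∧x∉q⇒x∈p─q; p─q⊆p; ⊆-antisym)
open import Data.Vec using (_∷_)
open import Data.Vec.Base using (here; there)
import Data.Vec.Properties as Vec
import Data.Bool as Bool
open import Data.Vec.Functional using (insertAt)
open import Data.Vec.Functional.Properties using (insertAt-lookup; insertAt-punchIn)
open import Data.Maybe using (just; nothing)
open import Data.Product using (Σ; ∃; _×_; _,_; proj₁; proj₂)
open import Data.Sum using (_⊎_; inj₁; inj₂; swap; map₂)
open import Data.Empty using (⊥-elim)
open import Data.Unit using (tt)
open import Function.Bundles using (_⇔_; mk⇔)
open import Relation.Nullary using (¬_; Dec; yes; no; contradiction)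
open import Relation.Nullary.Decidable using (decidable-stable)
open import Relation.Binary.PropositionalEquality using (_≡_; _≢_; refl; trans; subst; cong) renaming (sym to ≡-sym)

Values : (ℕ → Set) → ℕ∞ → Set
Values S v = ∃ λ s → v ≡ just s × S s

≤∞-nothing : ∀ m → m ≤∞ nothing
≤∞-nothing (just _) = tt
≤∞-nothing nothing  = tt

≤∞-weaken : ∀ m {a b} → m ≤∞ just a → a ≤ b → m ≤∞ just b
≤∞-weaken (just _) m≤a a≤b = ≤-trans m≤a a≤b

-- Finite upper bounds are decidable, hence stable under double negation.
_≤∞just?_ : ∀ m t → Dec (m ≤∞ just t)
just s  ≤∞just? t = s ≤? t
nothing ≤∞just? t = no λ ()

least⇒isMin : ∀ {S : ℕ → Set} {m} → S m → (∀ s → S s → m ≤ s) → IsMin (Values S) (just m)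
least⇒isMin {m = m} Sm least = inj₁ (m , refl , Sm) , λ { _ (s , refl , Ss) → least s Ss }

¬¬-least : (S : ℕ → Set) → ∀ {t} → S t →
           ¬ ¬ (∃ λ m → m ≤ t × S m × (∀ s → S s → m ≤ s))
¬¬-least S {t} St noLeast = noneBelow (suc t) t (n<1+n t) St
  where
  noneBelow : ∀ b s → s < b → ¬ S s
  noneBelow (suc b) s (s≤s s≤b) Ss = noLeast (s , isLeast t St , Ss , isLeast)
    where
    isLeast : ∀ r → S r → s ≤ r
    isLeast r Sr with s ≤? r
    ... | yes s≤r = s≤r
    ... | no  s≰r = ⊥-elim (noneBelow b r (≤-trans (≰⇒> s≰r) s≤b) Sr)

isMin-transfer : (S : ℕ → Set) (R : ℕ∞ → Set) →
  (∀ v → R v → v ≡ nothing ⊎ Values S v) →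
  (∀ s → S s → (∀ r → S r → s ≤ r) → R (just s)) →
  (∀ t → S t → ¬ ¬ (∃ λ u → u ≤ t × R (just u))) →
  ∀ m → IsMin (Values S) m ⇔ IsMin R m
isMin-transfer S R sound attained approached m = mk⇔ toR toS
  where
  lowerBoundR : (∀ v → Values S v → m ≤∞ v) → ∀ v → R v → m ≤∞ v
  lowerBoundR lbS v Rv with sound v Rv
  ... | inj₁ refl = ≤∞-nothing m
  ... | inj₂ Sv   = lbS v Sv

  lowerBoundS : (∀ v → R v → m ≤∞ v) → ∀ v → Values S v → m ≤∞ v
  lowerBoundS lbR _ (t , refl , St) = decidable-stable (m ≤∞just? t) λ m≰t →
    approached t St λ { (u , u≤t , Ru) → m≰t (≤∞-weaken m (lbR (just u) Ru) u≤t) }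

  toR : IsMin (Values S) m → IsMin R m
  toR (inj₁ (s , refl , Ss) , lbS) =
    inj₁ (attained s Ss λ r Sr → lbS (just r) (r , refl , Sr)) , lowerBoundR lbS
  toR (inj₂ refl , lbS) = inj₂ refl , lowerBoundR lbS

  toS : IsMin R m → IsMin (Values S) m
  toS (inj₁ Rm , lbR) = swap (sound m Rm) , lowerBoundS lbR
  toS (inj₂ refl , lbR) = inj₂ refl , lowerBoundS lbR

x∈p─q⇒x∉q : ∀ {n} {x : Fin n} (p q : Subset n) → x ∈ p ─ q → x ∉ q
x∈p─q⇒x∉q (inside  ∷ p) (outside ∷ q) here        = λ ()
x∈p─q⇒x∉q {x = Fin.zero} (_       ∷ p) (inside  ∷ q) ()
x∈p─q⇒x∉q {x = Fin.zero} (outside ∷ p) (outside ∷ q) ()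
x∈p─q⇒x∉q (_       ∷ p) (_       ∷ q) (there x∈) = λ { (there x∈q) → x∈p─q⇒x∉q p q x∈ x∈q }

∪-outside : ∀ {n} {x : Fin n} (p q : Subset n) → x ∈ p ∪ q → x ∉ p → x ∈ q
∪-outside p q x∈p∪q x∉p with x∈p∪q⁻ p q x∈p∪q
... | inj₁ x∈p = contradiction x∈p x∉p
... | inj₂ x∈q = x∈q

∪-─-absorb : ∀ {n} (p q : Subset n) → p ∪ (q ─ p) ≡ p ∪ q
∪-─-absorb p q = ⊆-antisym into onto
  where
  into : p ∪ (q ─ p) ⊆ p ∪ q
  into x∈ with x∈p∪q⁻ p (q ─ p) x∈
  ... | inj₁ x∈p   = p⊆p∪q q x∈p
  ... | inj₂ x∈q─p = q⊆p∪q p q (p─q⊆p q p x∈q─p)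
  onto : p ∪ q ⊆ p ∪ (q ─ p)
  onto {x} x∈ with x ∈? p
  ... | yes x∈p = p⊆p∪q (q ─ p) x∈p
  ... | no  x∉p = q⊆p∪q p (q ─ p) (x∈p∧x∉q⇒x∈p─q (∪-outside p q x∈ x∉p) x∉p)

∪-─-disjoint : ∀ {n} {X W : Subset n} → Disjoint X W → (X ∪ W) ─ X ≡ W
∪-─-disjoint {X = X} {W} X∩W=∅ = ⊆-antisym into onto
  where
  into : (X ∪ W) ─ X ⊆ W
  into x∈ = ∪-outside X W (p─q⊆p (X ∪ W) X x∈) (x∈p─q⇒x∉q (X ∪ W) X x∈)
  onto : W ⊆ (X ∪ W) ─ X
  onto {x} x∈W = x∈p∧x∉q⇒x∈p─q (q⊆p∪q X W x∈W) λ x∈X → X∩W=∅ x x∈X x∈W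

∪-absorb-⊆ : ∀ {n} {X Y W : Subset n} → Y ⊆ X ∪ W → X ∪ (Y ∪ W) ≡ X ∪ W
∪-absorb-⊆ {X = X} {Y} {W} Y⊆X∪W = ⊆-antisym into onto
  where
  onto : X ∪ W ⊆ X ∪ (Y ∪ W)
  onto x∈ = x∈p∪q⁺ (map₂ (q⊆p∪q Y W) (x∈p∪q⁻ X W x∈))
  into : X ∪ (Y ∪ W) ⊆ X ∪ W
  into x∈ with x∈p∪q⁻ X (Y ∪ W) x∈
  ... | inj₁ x∈X  = p⊆p∪q W x∈X
  ... | inj₂ x∈YW with x∈p∪q⁻ Y W x∈YW
  ...   | inj₁ x∈Y = Y⊆X∪W x∈Y
  ...   | inj₂ x∈W = q⊆p∪q X W x∈W

data LastOrInner {t : ℕ} : Fin (suc t) → Set where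
  isLast  : LastOrInner (fromℕ t)
  isInner : (j : Fin t) → LastOrInner (punchIn (fromℕ t) j)

lastOrInner : ∀ {t} (i : Fin (suc t)) → LastOrInner i
lastOrInner {t} i with fromℕ t ≟ i
... | yes refl = isLast
... | no  ℓ≢i  = subst LastOrInner (punchIn-punchOut ℓ≢i) (isInner (punchOut ℓ≢i))

last≰inner : ∀ {t} (j : Fin t) → ¬ (fromℕ t Fin.≤ punchIn (fromℕ t) j)
last≰inner {t} j ℓ≤j = punchInᵢ≢i (fromℕ t) j (≤-antisym (≤fromℕ _) ℓ≤j)

module _ {n : ℕ} {G : Graph n} {k : ℕ} where

  hasMSPD-resp : ∀ {X W W' s} → X ∪ W ≡ X ∪ W' → HasMSPD G k X W s → HasMSPD G k X W' s
  hasMSPD-resp {X} {s = suc t} X∪W≡X∪W' =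
    subst (λ H → Σ (PathDecomposition G k H (suc t)) λ P → PathDecomposition.bag P (fromℕ t) ≡ X)
          X∪W≡X∪W'

  -- Occurrences of a
  -- vertex stay an interval because X meets H only inside the last bag of Q;
  -- edges from X to H ∖ X start in H, so Q already covers them.
  module AppendBag {H X : Subset n} {t : ℕ} (Q : PathDecomposition G k H (suc t))
    (|X|≤k+1 : ∣ X ∣ ≤ suc k)
    (X∩H⊆last : ∀ {v} → v ∈ X → v ∈ H → v ∈ PathDecomposition.bag Q (fromℕ t))
    (crossing : ∀ u v → u ∈ X → v ∈ H → v ∉ X → E G u v → u ∈ H) where

    private module Q = PathDecomposition Q

    ℓ : Fin (suc (suc t))
    ℓ = fromℕ (suc t)

    bags : Fin (suc (suc t)) → Subset n
    bags = insertAt Q.bag ℓ X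

    lastBag : bags ℓ ≡ X
    lastBag = insertAt-lookup Q.bag ℓ X

    innerBag : ∀ j → bags (punchIn ℓ j) ≡ Q.bag j
    innerBag = insertAt-punchIn Q.bag ℓ X

    toLast : ∀ {v} → v ∈ X → v ∈ bags ℓ
    toLast {v} = subst (v ∈_) (≡-sym lastBag)

    fromLast : ∀ {v} → v ∈ bags ℓ → v ∈ X
    fromLast {v} = subst (v ∈_) lastBag

    toInner : ∀ {v} j → v ∈ Q.bag j → v ∈ bags (punchIn ℓ j)
    toInner {v} j = subst (v ∈_) (≡-sym (innerBag j))

    fromInner : ∀ {v} j → v ∈ bags (punchIn ℓ j) → v ∈ Q.bag j
    fromInner {v} j = subst (v ∈_) (innerBag j)

    inH : ∀ i → bags i ⊆ X ∪ H
    inH i with lastOrInner i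
    ... | isLast    = λ v∈ → p⊆p∪q H (fromLast v∈)
    ... | isInner j = λ v∈ → q⊆p∪q X H (Q.inH j (fromInner j v∈))

    width : ∀ i → ∣ bags i ∣ ≤ suc k
    width i with lastOrInner i
    ... | isLast    = subst (λ B → ∣ B ∣ ≤ suc k) (≡-sym lastBag) |X|≤k+1
    ... | isInner j = subst (λ B → ∣ B ∣ ≤ suc k) (≡-sym (innerBag j)) (Q.width j)

    vcover : ∀ v → v ∈ X ∪ H → ∃ λ i → v ∈ bags i
    vcover v v∈ with v ∈? X
    ... | yes v∈X = ℓ , toLast v∈X
    ... | no  v∉X with Q.vcover v (∪-outside X H v∈ v∉X)
    ...   | j , v∈j = punchIn ℓ j , toInner j v∈j

    coveredByQ : ∀ u v → u ∈ H → v ∈ H → E G u v → ∃ λ i → u ∈ bags i × v ∈ bags i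
    coveredByQ u v u∈H v∈H e with Q.ecover u v u∈H v∈H e
    ... | j , u∈j , v∈j = punchIn ℓ j , toInner j u∈j , toInner j v∈j

    ecover : ∀ u v → u ∈ X ∪ H → v ∈ X ∪ H → E G u v → ∃ λ i → u ∈ bags i × v ∈ bags i
    ecover u v u∈ v∈ e with u ∈? X | v ∈? X
    ... | yes u∈X | yes v∈X = ℓ , toLast u∈X , toLast v∈X
    ... | yes u∈X | no  v∉X =
      let v∈H = ∪-outside X H v∈ v∉X in coveredByQ u v (crossing u v u∈X v∈H v∉X e) v∈H e
    ... | no  u∉X | yes v∈X =
      let u∈H = ∪-outside X H u∈ u∉X in
      coveredByQ u v u∈H (crossing v u v∈X u∈H u∉X (Graph.sym G e)) e
    ... | no  u∉X | no  v∉X = coveredByQ u v (∪-outside X H u∈ u∉X) (∪-outside X H v∈ v∉X) e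

    interval : ∀ v (i j l : Fin (suc (suc t))) → i Fin.≤ j → j Fin.≤ l →
               v ∈ bags i → v ∈ bags l → v ∈ bags j
    interval v i j l i≤j j≤l v∈i v∈l with lastOrInner i | lastOrInner j | lastOrInner l
    ... | _         | isLast    | isLast    = v∈l
    ... | _         | isLast    | isInner c = contradiction j≤l (last≰inner c)
    ... | isLast    | isInner b | _         = contradiction i≤j (last≰inner b)
    ... | isInner a | isInner b | isInner c =
      toInner b (Q.interval v a b c (punchIn-cancel-≤ ℓ a b i≤j) (punchIn-cancel-≤ ℓ b c j≤l)
                                    (fromInner a v∈i) (fromInner c v∈l))
    ... | isInner a | isInner b | isLast    =
      toInner b (Q.interval v a b (fromℕ t) (punchIn-cancel-≤ ℓ a b i≤j) (≤fromℕ b) v∈a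
                                    (X∩H⊆last (fromLast v∈l) (Q.inH a v∈a)))
      where
      v∈a : v ∈ Q.bag a
      v∈a = fromInner a v∈i

    decomposition : HasMSPD G k X H (suc (suc t))
    decomposition = record
      { bag = bags ; inH = inH ; width = width ; vcover = vcover
      ; ecover = ecover ; interval = interval } , lastBag

  appendBag : ∀ {H X t} (Q : PathDecomposition G k H (suc t)) → ∣ X ∣ ≤ suc k →
    (∀ {v} → v ∈ X → v ∈ H → v ∈ PathDecomposition.bag Q (fromℕ t)) →
    (∀ u v → u ∈ X → v ∈ H → v ∉ X → E G u v → u ∈ H) →
    HasMSPD G k X H (suc (suc t))
  appendBag = AppendBag.decomposition

  -- Removing the last bag X of a decomposition P of G[H]; Y is the new last
  -- bag.  By the interval property an earlier bag meets X only inside Y.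
  module DropLastBag {H X : Subset n} {t : ℕ} (P : PathDecomposition G k H (suc (suc t)))
    (lastIsX : PathDecomposition.bag P (fromℕ (suc t)) ≡ X) where

    private module P = PathDecomposition P

    ℓ : Fin (suc (suc t))
    ℓ = fromℕ (suc t)

    inner : Fin (suc t) → Fin (suc (suc t))
    inner = punchIn ℓ

    Y : Subset n
    Y = P.bag (inner (fromℕ t))

    Y⊆H : Y ⊆ H
    Y⊆H = P.inH (inner (fromℕ t))

    toLast : ∀ {v} → v ∈ X → v ∈ P.bag ℓ
    toLast {v} = subst (v ∈_) (≡-sym lastIsX)

    fromLast : ∀ {v} → v ∈ P.bag ℓ → v ∈ X
    fromLast {v} = subst (v ∈_) lastIsX

    innerMeetsXInY : ∀ j {v} → v ∈ P.bag (inner j) → v ∈ X → v ∈ Y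
    innerMeetsXInY j {v} v∈j v∈X =
      P.interval v (inner j) (inner (fromℕ t)) ℓ (punchIn-mono-≤ ℓ j (fromℕ t) (≤fromℕ j))
                 (≤fromℕ _) v∈j (toLast v∈X)

    -- No edge joins X ∖ Y to H ∖ X: it would have to lie in an earlier bag.
    separated : ∀ x w → x ∈ X → x ∉ Y → w ∈ H → w ∉ X → ¬ E G x w
    separated x w x∈X x∉Y w∈H w∉X e with P.ecover x w (P.inH ℓ (toLast x∈X)) w∈H e
    ... | i , x∈i , w∈i with lastOrInner i
    ...   | isLast    = w∉X (fromLast w∈i)
    ...   | isInner j = x∉Y (innerMeetsXInY j x∈i x∈X)

    inY : ∀ {v} → v ∈ Y ∪ (H ─ X) → v ∈ X → v ∈ Y
    inY v∈ v∈X with x∈p∪q⁻ Y (H ─ X) v∈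
    ... | inj₁ v∈Y   = v∈Y
    ... | inj₂ v∈H─X = contradiction v∈X (x∈p─q⇒x∉q H X v∈H─X)

    inH : ∀ j → P.bag (inner j) ⊆ Y ∪ (H ─ X)
    inH j {v} v∈j with v ∈? X
    ... | yes v∈X = p⊆p∪q (H ─ X) (innerMeetsXInY j v∈j v∈X)
    ... | no  v∉X = q⊆p∪q Y (H ─ X) (x∈p∧x∉q⇒x∈p─q (P.inH (inner j) v∈j) v∉X)

    vcover : ∀ v → v ∈ Y ∪ (H ─ X) → ∃ λ j → v ∈ P.bag (inner j)
    vcover v v∈ with x∈p∪q⁻ Y (H ─ X) v∈
    ... | inj₁ v∈Y   = fromℕ t , v∈Y
    ... | inj₂ v∈H─X with P.vcover v (p─q⊆p H X v∈H─X)
    ...   | i , v∈i with lastOrInner i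
    ...     | isLast    = contradiction (fromLast v∈i) (x∈p─q⇒x∉q H X v∈H─X)
    ...     | isInner j = j , v∈i

    restInH : Y ∪ (H ─ X) ⊆ H
    restInH v∈ with x∈p∪q⁻ Y (H ─ X) v∈
    ... | inj₁ v∈Y   = Y⊆H v∈Y
    ... | inj₂ v∈H─X = p─q⊆p H X v∈H─X

    -- An edge covered only by the last bag X has both ends in Y.
    ecover : ∀ u v → u ∈ Y ∪ (H ─ X) → v ∈ Y ∪ (H ─ X) → E G u v →
             ∃ λ j → u ∈ P.bag (inner j) × v ∈ P.bag (inner j)
    ecover u v u∈ v∈ e with P.ecover u v (restInH u∈) (restInH v∈) e
    ... | i , u∈i , v∈i with lastOrInner i
    ...   | isLast    = fromℕ t , inY u∈ (fromLast u∈i) , inY v∈ (fromLast v∈i)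
    ...   | isInner j = j , u∈i , v∈i

    decomposition : HasMSPD G k Y (H ─ X) (suc t)
    decomposition = record
      { bag = λ j → P.bag (inner j)
      ; inH = inH
      ; width = λ j → P.width (inner j)
      ; vcover = vcover
      ; ecover = ecover
      ; interval = λ v a b c a≤b b≤c →
          P.interval v (inner a) (inner b) (inner c) (punchIn-mono-≤ ℓ a b a≤b) (punchIn-mono-≤ ℓ b c b≤c)
      } , refl

  dropLastBag : ∀ {H X t} (P : PathDecomposition G k H (suc (suc t))) →
    PathDecomposition.bag P (fromℕ (suc t)) ≡ X →
    Σ (Subset n) λ Y → Y ⊆ H × (∀ x w → x ∈ X → x ∉ Y → w ∈ H → w ∉ X → ¬ E G x w)
                       × HasMSPD G k Y (H ─ X) (suc t)
  dropLastBag P lastIsX = Y , Y⊆H , separated , decomposition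
    where open DropLastBag P lastIsX

module Recurrence {n : ℕ} (G : Graph n) (k : ℕ) (X W : Subset n)
  (|X|≤k+1 : ∣ X ∣ ≤ suc k) (X∩W=∅ : Disjoint X W) (W≢∅ : Nonempty W) where

  NoEdgeFrom : Subset n → Set
  NoEdgeFrom Y = ∀ w → w ∈ W → ¬ InN G (X ─ Y) w

  extend : ∀ {Y} → Y ⊆ X ∪ W → NoEdgeFrom Y →
           ∀ s → HasMSPD G k Y (W ─ Y) s → HasMSPD G k X W (suc s)
  extend {Y} Y⊆X∪W noEdge (suc t) (Q , lastIsY) =
    hasMSPD-resp X∪rest≡X∪W (appendBag Q |X|≤k+1 meetsInY crossing)
    where
    meetsInY : ∀ {v} → v ∈ X → v ∈ Y ∪ (W ─ Y) → v ∈ PathDecomposition.bag Q (fromℕ t)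
    meetsInY {v} v∈X v∈ with x∈p∪q⁻ Y (W ─ Y) v∈
    ... | inj₁ v∈Y   = subst (v ∈_) (≡-sym lastIsY) v∈Y
    ... | inj₂ v∈W─Y = ⊥-elim (X∩W=∅ v v∈X (p─q⊆p W Y v∈W─Y))

    inW : ∀ {v} → v ∈ Y ∪ (W ─ Y) → v ∉ X → v ∈ W
    inW v∈ v∉X with x∈p∪q⁻ Y (W ─ Y) v∈
    ... | inj₁ v∈Y   = ∪-outside X W (Y⊆X∪W v∈Y) v∉X
    ... | inj₂ v∈W─Y = p─q⊆p W Y v∈W─Y

    crossing : ∀ u v → u ∈ X → v ∈ Y ∪ (W ─ Y) → v ∉ X → E G u v → u ∈ Y ∪ (W ─ Y)
    crossing u v u∈X v∈ v∉X e with u ∈? Y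
    ... | yes u∈Y = p⊆p∪q (W ─ Y) u∈Y
    ... | no  u∉Y = ⊥-elim (noEdge v (inW v∈ v∉X) (u , x∈p∧x∉q⇒x∈p─q u∈X u∉Y , e))

    X∪rest≡X∪W : X ∪ (Y ∪ (W ─ Y)) ≡ X ∪ W
    X∪rest≡X∪W = trans (cong (X ∪_) (∪-─-absorb Y W)) (∪-absorb-⊆ Y⊆X∪W)

  -- Every size s+1 for (X, W) comes from a size s for some (Y, W ∖ Y), Y the
  -- second-to-last bag; a single bag X cannot cover the nonempty W.
  restrict : ∀ t → HasMSPD G k X W (suc t) →
             Σ (Subset n) λ Y → Y ⊆ X ∪ W × NoEdgeFrom Y × HasMSPD G k Y (W ─ Y) t
  restrict zero (P , lastIsX) with PathDecomposition.vcover P (proj₁ W≢∅) (q⊆p∪q X W (proj₂ W≢∅))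
  ... | Fin.zero , w∈X = ⊥-elim (X∩W=∅ _ (subst (_ ∈_) lastIsX w∈X) (proj₂ W≢∅))
  restrict (suc t) (P , lastIsX) with dropLastBag P lastIsX
  ... | Y , Y⊆X∪W , separated , h = Y , Y⊆X∪W , noEdge , hasMSPD-resp Y∪rest≡Y∪W─Y h
    where
    noEdge : NoEdgeFrom Y
    noEdge w w∈W (x , x∈X─Y , e) =
      separated x w (p─q⊆p X Y x∈X─Y) (x∈p─q⇒x∉q X Y x∈X─Y) (q⊆p∪q X W w∈W)
                (λ w∈X → X∩W=∅ w w∈X w∈W) e
    Y∪rest≡Y∪W─Y : Y ∪ ((X ∪ W) ─ X) ≡ Y ∪ (W ─ Y)
    Y∪rest≡Y∪W─Y = trans (cong (Y ∪_) (∪-─-disjoint X∩W=∅)) (≡-sym (∪-─-absorb Y W))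

  sameLast : ∀ {s} → HasMSPD G k X (W ─ X) s → HasMSPD G k X W s
  sameLast = hasMSPD-resp (∪-─-absorb X W)

  sound : ∀ v → RecValues G k X W v → v ≡ nothing ⊎ Values (HasMSPD G k X W) v
  sound _ (Y , _ , (Y⊆X∪W , _ , noEdge) , (inj₁ (s , refl , h) , _) , refl) =
    inj₂ (suc s , refl , extend Y⊆X∪W noEdge s h)
  sound _ (_ , _ , _ , (inj₂ refl , _) , refl) = inj₁ refl

  -- For a least size, the second-to-last bag is admissible (Y = X would give
  -- a smaller size) and its size is least for (Y, W ∖ Y) (by extend).
  attained : ∀ s → HasMSPD G k X W s → (∀ r → HasMSPD G k X W r → s ≤ r) →
             RecValues G k X W (just s)
  attained (suc t) h least with restrict t h
  ... | Y , Y⊆X∪W , noEdge , h′ =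
    Y , just t , (Y⊆X∪W , Y≢X , noEdge) , least⇒isMin h′ leastForY , refl
    where
    Y≢X : Y ≢ X
    Y≢X refl = 1+n≰n (least t (sameLast h′))
    leastForY : ∀ r → HasMSPD G k Y (W ─ Y) r → t ≤ r
    leastForY r h″ = s≤s⁻¹ (least (suc r) (extend Y⊆X∪W noEdge r h″))

  -- Induction on the size: strip bags while the second-to-last bag equals X;
  -- at the first admissible Y, 1 + mspd_k(Y, W ∖ Y) is at most the size.
  approached : ∀ t → HasMSPD G k X W t → ¬ ¬ (∃ λ u → u ≤ t × RecValues G k X W (just u))
  approached (suc t) h with restrict t h
  ... | Y , Y⊆X∪W , noEdge , h′ with Vec.≡-dec Bool._≟_ Y X
  ...   | yes refl = λ noValue →
    approached t (sameLast h′) λ { (u , u≤t , Ru) → noValue (u , m≤n⇒m≤1+n u≤t , Ru) }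
  ...   | no  Y≢X  = λ noValue →
    ¬¬-least (HasMSPD G k Y (W ─ Y)) h′ λ { (m , m≤t , Sm , least) →
      noValue (suc m , s≤s m≤t , (Y , just m , (Y⊆X∪W , Y≢X , noEdge) , least⇒isMin Sm least , refl)) }

  mspd-recurrence : ∀ m → MspdIs G k X W m ⇔ IsMin (RecValues G k X W) m
  mspd-recurrence = isMin-transfer (HasMSPD G k X W) (RecValues G k X W) sound attained approached

singleBag : ∀ {n} (G : Graph n) (k : ℕ) (X : Subset n) → ∣ X ∣ ≤ suc k → MspdIs G k X ⊥ (just 1)
singleBag G k X |X|≤k+1 = least⇒isMin (record
  { bag = λ _ → X ; inH = λ _ → p⊆p∪q ⊥ ; width = λ _ → |X|≤k+1
  ; vcover = λ v v∈ → Fin.zero , inX v∈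
  ; ecover = λ u v u∈ v∈ _ → Fin.zero , inX u∈ , inX v∈
  ; interval = λ _ _ _ _ _ _ _ v∈l → v∈l } , refl) oneBagLeast
  where
  inX : ∀ {v} → v ∈ X ∪ ⊥ → v ∈ X
  inX v∈ with x∈p∪q⁻ X ⊥ v∈
  ... | inj₁ v∈X = v∈X
  ... | inj₂ v∈⊥ = contradiction v∈⊥ ∉⊥
  oneBagLeast : ∀ s → HasMSPD G k X ⊥ s → 1 ≤ s
  oneBagLeast (suc _) _ = s≤s z≤n

lemma4 : ∀ {n : ℕ} (k : ℕ) (G : Graph n) → 1 ≤ k → TwAtMost G k →
    ((X : Subset n) → ∣ X ∣ ≤ suc k → MspdIs G k X ⊥ (just 1))
    × ((X W : Subset n) → GoodPair G k X W → Nonempty W →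
       ∀ m → MspdIs G k X W m ⇔ IsMin (RecValues G k X W) m)
lemma4 k G _ _ =
  singleBag G k ,
  λ { X W (|X|≤k+1 , X∩W=∅ , _) W≢∅ → Recurrence.mspd-recurrence G k X W |X|≤k+1 X∩W=∅ W≢∅ }
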